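{- For every hypersequent $G$: if the inequality $[\![G]\!]\geq 0$ is derivable in equational logic from the axioms of Riesz spaces (equivalently, holds in every Riesz space under every assignment of the variables), then $G$ is derivable in the hypersequent calculus $\mathbf{HR}$.
   Context: Terms. Fix a countable set of variables $x,y,z,\dots$. Terms (in negation normal form) are generated by $A ::= x \mid \overline{x} \mid 0 \mid A+A \mid rA \mid A\sqcup A \mid A\sqcap A$, where $x$ is a variable, $\overline{x}$ is the corresponding negated variable, and $r\in\mathbb{R}_{>0}$. The negation $\overline{A}$ of a term is defined by $\overline{x}$ (for $x$), $\overline{\overline{x}}=x$, $\overline{0}=0$, $\overline{A+B}=\overline{A}+\overline{B}$, $\overline{rA}=r\overline{A}$, $\overline{A\sqcup B}=\overline{A}\sqcap\overline{B}$, $\overline{A\sqcap B}=\overline{A}\sqcup\overline{B}$. Terms are interpreted in Riesz spaces (vector lattices) reading $\overline{x}$ as $-x$, $rA$ as scalar multiplication, and $\sqcup,\sqcap$ as join and meet. A weighted term is $r.A$ with $r\in\mathbb{R}_{>0}$; a sequent $\vdash\Gamma$ has $\Gamma$ a finite (possibly empty) multiset of weighted terms; a hypersequent is a nonempty finite multiset of sequents, written $\vdash\Gamma_1\mid\cdots\mid\vdash\Gamma_n$, and $G\mid\vdash\Gamma$ denotes the hypersequent $G$ with the sequent $\vdash\Gamma$ added. For a finite (possibly empty) sequence $\vec r=(r_1,\dots,r_n)$ of strictly positive reals, $\vec r.A$ is the multiset $r_1.A,\dots,r_n.A$, $\sum\vec r=r_1+\dots+r_n$, and $s\vec r=(sr_1,\dots,sr_n)$;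 for $s>0$, $s.\Gamma$ multiplies every weight in $\Gamma$ by $s$. Interpretation: $[\![r.A]\!]=rA$; $[\![\vdash r_1.A_1,\dots,r_n.A_n]\!]=r_1A_1+\dots+r_nA_n$ (empty sum $=0$); $[\![\vdash\Gamma_1\mid\dots\mid\vdash\Gamma_n]\!]=[\![\vdash\Gamma_1]\!]\sqcup\dots\sqcup[\![\vdash\Gamma_n]\!]$. The calculus $\mathbf{HR}$ has the rules (vectors are finite sequences of strictly positive reals): INIT: the hypersequent $\vdash$ (one empty sequent) with no premises. W: from $G$ infer $G\mid\vdash\Gamma$. C: from $G\mid\vdash\Gamma\mid\vdash\Gamma$ infer $G\mid\vdash\Gamma$. S: from $G\mid\vdash\Gamma_1,\Gamma_2$ infer $G\mid\vdash\Gamma_1\mid\vdash\Gamma_2$. M: from $G\mid\vdash\Gamma_1$ and $G\mid\vdash\Gamma_2$ infer $G\mid\vdash\Gamma_1,\Gamma_2$. T: for $r>0$, from $G\mid\vdash r.\Gamma$ infer $G\mid\vdash\Gamma$. ID: if $\sum\vec r=\sum\vec s$, from $G\mid\vdash\Gamma$ infer $G\mid\vdash\Gamma,\vec r.x,\vec s.\overline{x}$ ($x$ a variable). 0: from $G\mid\vdash\Gamma$ infer $G\mid\vdash\Gamma,\vec r.0$. $+$: from $G\mid\vdash\Gamma,\vec r.A,\vec r.B$ infer $G\mid\vdash\Gamma,\vec r.(A+B)$. $\times$: from $G\mid\vdash\Gamma,(s\vec r).A$ infer $G\mid\vdash\Gamma,\vec r.(sA)$. $\sqcup$: from $G\mid\vdash\Gamma,\vec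 r.A\mid\vdash\Gamma,\vec r.B$ infer $G\mid\vdash\Gamma,\vec r.(A\sqcup B)$. $\sqcap$: from $G\mid\vdash\Gamma,\vec r.A$ and $G\mid\vdash\Gamma,\vec r.B$ infer $G\mid\vdash\Gamma,\vec r.(A\sqcap B)$. CAN: if $\sum\vec r=\sum\vec s$, from $G\mid\vdash\Gamma,\vec s.A,\vec r.\overline{A}$ infer $G\mid\vdash\Gamma$. A derivation is a finite tree of rule instances whose leaves are INIT. -}

module Defs where

open import Level using (0ℓ)
open import Data.Nat using (ℕ)
open import Data.Product using (Σ; ∃; _×_; _,_; proj₁)
open import Data.Sum using (_⊎_)
open import Data.List using (List; []; _∷_; _++_; map)
open import Data.List.Relation.Binary.Permutation.Propositional using (_↭_)
open import Relation.Binary.PropositionalEquality using (_≡_)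
open import Relation.Nullary using (¬_)
open import Algebra.Structures using (IsCommutativeRing)
open import Relation.Binary.Structures using (IsStrictTotalOrder)

-- Every model is (classically)
-- isomorphic to ℝ, so quantifying over all models is faithful.

record Reals : Set₁ where
  infixl 6 _+_
  infixl 7 _*_
  infix 4 _<_ _≤_
  field
    ℝ : Set
    0ℝ 1ℝ : ℝ
    _+_ _*_ : ℝ → ℝ → ℝ
    -_ : ℝ → ℝ
    _<_ : ℝ → ℝ → Set
    isCommutativeRing : IsCommutativeRing _≡_ _+_ _*_ -_ 0ℝ 1ℝ
    0≢1 : ¬ (0ℝ ≡ 1ℝ)
    inverse : ∀ x → ¬ (x ≡ 0ℝ) → ∃ λ y → x * y ≡ 1ℝ
    isStrictTotalOrder : IsStrictTotalOrder _≡_ _<_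
    +-mono-< : ∀ {x y} z → x < y → x + z < y + z
    *-pos : ∀ {x y} → 0ℝ < x → 0ℝ < y → 0ℝ < x * y

  _≤_ : ℝ → ℝ → Set
  x ≤ y = x < y ⊎ x ≡ y

  field
    complete : (P : ℝ → Set) → ∃ P → (∃ λ b → ∀ x → P x → x ≤ b) →
               ∃ λ s → (∀ x → P x → x ≤ s) × (∀ b → (∀ x → P x → x ≤ b) → s ≤ b)

module Syntax (R : Reals) where
  open Reals R

  ℝ⁺ : Set
  ℝ⁺ = Σ ℝ (λ r → 0ℝ < r)

  _*⁺_ : ℝ⁺ → ℝ⁺ → ℝ⁺
  (r , p) *⁺ (s , q) = r * s , *-pos p q

  Σ⃗ : List ℝ⁺ → ℝ
  Σ⃗ [] = 0ℝ
  Σ⃗ (r ∷ rs) = proj₁ r + Σ⃗ rs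

  -- terms in negation normal form; variables are natural numbers
  infixl 6 _⊕_
  data Term : Set where
    var   : ℕ → Term
    covar : ℕ → Term
    𝟘     : Term
    _⊕_   : Term → Term → Term
    _●_   : ℝ⁺ → Term → Term
    _⊔_   : Term → Term → Term
    _⊓_   : Term → Term → Term

  neg : Term → Term
  neg (var x) = covar x
  neg (covar x) = var x
  neg 𝟘 = 𝟘
  neg (A ⊕ B) = neg A ⊕ neg B
  neg (r ● A) = r ● neg A
  neg (A ⊔ B) = neg A ⊓ neg B
  neg (A ⊓ B) = neg A ⊔ neg B

  -- weighted terms, sequents (multisets as lists up to permutation),
  -- hypersequents (nonempty multisets of sequents; written Γ ∷ G)
  WTerm : Set
  WTerm = ℝ⁺ × Term

  Sequent : Set
  Sequent = List WTerm

  _·_ : List ℝ⁺ → Term → Sequent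
  rs · A = map (λ r → r , A) rs

  scale : ℝ⁺ → Sequent → Sequent
  scale s = map (λ { (r , A) → (s *⁺ r) , A })

  scaleV : ℝ⁺ → List ℝ⁺ → List ℝ⁺
  scaleV s = map (s *⁺_)

  -- The calculus HR (hypersequents are lists of sequents; multiset
  -- structure is recovered by the exchange rules exH and exS).
  data HR : List Sequent → Set where
    INIT : HR ([] ∷ [])
    exH  : ∀ {G G′} → G ↭ G′ → HR G → HR G′
    exS  : ∀ {Γ Γ′ G} → Γ ↭ Γ′ → HR (Γ ∷ G) → HR (Γ′ ∷ G)
    W    : ∀ {G Γ} → HR G → HR (Γ ∷ G)
    C    : ∀ {G Γ} → HR (Γ ∷ Γ ∷ G) → HR (Γ ∷ G)
    S    : ∀ {G Γ₁ Γ₂} → HR ((Γ₁ ++ Γ₂) ∷ G) → HR (Γ₁ ∷ Γ₂ ∷ G)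
    M    : ∀ {G Γ₁ Γ₂} → HR (Γ₁ ∷ G) → HR (Γ₂ ∷ G) → HR ((Γ₁ ++ Γ₂) ∷ G)
    T    : ∀ {G Γ} (r : ℝ⁺) → HR (scale r Γ ∷ G) → HR (Γ ∷ G)
    ID   : ∀ {G Γ} (rs ss : List ℝ⁺) (x : ℕ) → Σ⃗ rs ≡ Σ⃗ ss →
           HR (Γ ∷ G) → HR ((Γ ++ rs · var x ++ ss · covar x) ∷ G)
    ZERO : ∀ {G Γ} (rs : List ℝ⁺) → HR (Γ ∷ G) → HR ((Γ ++ rs · 𝟘) ∷ G)
    PLUS : ∀ {G Γ} (rs : List ℝ⁺) (A B : Term) →
           HR ((Γ ++ rs · A ++ rs · B) ∷ G) → HR ((Γ ++ rs · (A ⊕ B)) ∷ G)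
    TIMES : ∀ {G Γ} (rs : List ℝ⁺) (s : ℝ⁺) (A : Term) →
           HR ((Γ ++ scaleV s rs · A) ∷ G) → HR ((Γ ++ rs · (s ● A)) ∷ G)
    JOIN : ∀ {G Γ} (rs : List ℝ⁺) (A B : Term) →
           HR ((Γ ++ rs · A) ∷ (Γ ++ rs · B) ∷ G) → HR ((Γ ++ rs · (A ⊔ B)) ∷ G)
    MEET : ∀ {G Γ} (rs : List ℝ⁺) (A B : Term) →
           HR ((Γ ++ rs · A) ∷ G) → HR ((Γ ++ rs · B) ∷ G) →
           HR ((Γ ++ rs · (A ⊓ B)) ∷ G)
    CAN  : ∀ {G Γ} (rs ss : List ℝ⁺) (A : Term) → Σ⃗ rs ≡ Σ⃗ ss →
           HR ((Γ ++ ss · A ++ rs · neg A) ∷ G) → HR (Γ ∷ G)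

  infixl 6 _+ᵗ_
  data RTerm : Set where
    v    : ℕ → RTerm
    0ᵗ   : RTerm
    _+ᵗ_ : RTerm → RTerm → RTerm
    _•_  : ℝ → RTerm → RTerm
    _∨_  : RTerm → RTerm → RTerm
    _∧_  : RTerm → RTerm → RTerm

  data Axiom : RTerm → RTerm → Set where
    +-assoc : ∀ a b c → Axiom (a +ᵗ (b +ᵗ c)) ((a +ᵗ b) +ᵗ c)
    +-comm  : ∀ a b → Axiom (a +ᵗ b) (b +ᵗ a)
    +-idʳ   : ∀ a → Axiom (a +ᵗ 0ᵗ) a
    +-invʳ  : ∀ a → Axiom (a +ᵗ ((- 1ℝ) • a)) 0ᵗ
    •-assoc : ∀ r s a → Axiom (r • (s • a)) ((r * s) • a)
    •-one   : ∀ a → Axiom (1ℝ • a) a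
    •-distˡ : ∀ r a b → Axiom (r • (a +ᵗ b)) ((r • a) +ᵗ (r • b))
    •-distʳ : ∀ r s a → Axiom ((r + s) • a) ((r • a) +ᵗ (s • a))
    ∨-assoc : ∀ a b c → Axiom (a ∨ (b ∨ c)) ((a ∨ b) ∨ c)
    ∧-assoc : ∀ a b c → Axiom (a ∧ (b ∧ c)) ((a ∧ b) ∧ c)
    ∨-comm  : ∀ a b → Axiom (a ∨ b) (b ∨ a)
    ∧-comm  : ∀ a b → Axiom (a ∧ b) (b ∧ a)
    ∨-absorb : ∀ a b → Axiom (a ∨ (a ∧ b)) a
    ∧-absorb : ∀ a b → Axiom (a ∧ (a ∨ b)) a
    ∨-idem  : ∀ a → Axiom (a ∨ a) a
    ∧-idem  : ∀ a → Axiom (a ∧ a) a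
    -- compatibility: (a ⊓ b) + c ≤ b + c ;  r(a ⊓ b) ≤ r b for r ≥ 0
    +-compat : ∀ a b c → Axiom (((a ∧ b) +ᵗ c) ∧ (b +ᵗ c)) ((a ∧ b) +ᵗ c)
    •-compat : ∀ r a b → 0ℝ ≤ r → Axiom ((r • (a ∧ b)) ∧ (r • b)) (r • (a ∧ b))

  infix 4 _≈ₑ_
  data _≈ₑ_ : RTerm → RTerm → Set where
    ax    : ∀ {a b} → Axiom a b → a ≈ₑ b
    refl  : ∀ {a} → a ≈ₑ a
    sym   : ∀ {a b} → a ≈ₑ b → b ≈ₑ a
    trans : ∀ {a b c} → a ≈ₑ b → b ≈ₑ c → a ≈ₑ c
    +-cong : ∀ {a a′ b b′} → a ≈ₑ a′ → b ≈ₑ b′ → a +ᵗ b ≈ₑ a′ +ᵗ b′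
    •-cong : ∀ {a a′} r → a ≈ₑ a′ → r • a ≈ₑ r • a′
    ∨-cong : ∀ {a a′ b b′} → a ≈ₑ a′ → b ≈ₑ b′ → a ∨ b ≈ₑ a′ ∨ b′
    ∧-cong : ∀ {a a′ b b′} → a ≈ₑ a′ → b ≈ₑ b′ → a ∧ b ≈ₑ a′ ∧ b′

  infix 4 _≤ₑ_
  _≤ₑ_ : RTerm → RTerm → Set
  a ≤ₑ b = a ∧ b ≈ₑ a

  ⟦_⟧ᵗ : Term → RTerm
  ⟦ var x ⟧ᵗ = v x
  ⟦ covar x ⟧ᵗ = (- 1ℝ) • v x
  ⟦ 𝟘 ⟧ᵗ = 0ᵗ
  ⟦ A ⊕ B ⟧ᵗ = ⟦ A ⟧ᵗ +ᵗ ⟦ B ⟧ᵗ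
  ⟦ r ● A ⟧ᵗ = proj₁ r • ⟦ A ⟧ᵗ
  ⟦ A ⊔ B ⟧ᵗ = ⟦ A ⟧ᵗ ∨ ⟦ B ⟧ᵗ
  ⟦ A ⊓ B ⟧ᵗ = ⟦ A ⟧ᵗ ∧ ⟦ B ⟧ᵗ

  ⟦_⟧ˢ : Sequent → RTerm
  ⟦ [] ⟧ˢ = 0ᵗ
  ⟦ (r , A) ∷ Γ ⟧ˢ = (proj₁ r • ⟦ A ⟧ᵗ) +ᵗ ⟦ Γ ⟧ˢ

  ⟦_∣_⟧ʰ : Sequent → List Sequent → RTerm
  ⟦ Γ ∣ [] ⟧ʰ = ⟦ Γ ⟧ˢ
  ⟦ Γ ∣ Δ ∷ G ⟧ʰ = ⟦ Γ ⟧ˢ ∨ ⟦ Δ ∣ G ⟧ʰ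

-- Write A ⊑ B when, for all weight vectors r⃗, s⃗ with Σ r⃗ = Σ s⃗, the formulas r⃗.B, s⃗.Ā can be
-- added to any derivable hypersequent.  Generalised ID makes ⊑ reflexive, CAN makes it
-- transitive, and the logical rules make every connective monotone and ⊔, ⊓ a join and a meet.
-- The vector-space axioms hold because their two sides are linear combinations of the same
-- subterms with equal coefficients: decomposing both with the + and × rules leaves, for each
-- subterm, positive and negative occurrences of equal total weight, which ID closes.  Hence an
-- equation derivable from the Riesz-space axioms holds for ⊑ in both directions, and 0 ≤ ⟦G⟧
-- yields ⊢ 1.⟦G⟧.  Finally M and CAN let us cut 1.⟦Γ⟧ against Γ, and the ⊔ rule is invertible
-- by two such cuts, which recovers G from ⊢ 1.⟦G⟧.

module Submission where

open import Level using (0ℓ)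
open import Defs
open import Data.Bool using (Bool; true; false; not)
open import Data.Empty using (⊥-elim)
open import Data.Fin using (Fin; zero; suc)
open import Data.List using (List; []; _∷_; _++_)
import Data.List.Properties as List
open import Data.List.Relation.Binary.Permutation.Propositional
  using (_↭_; ↭-refl; ↭-trans; ↭-reflexive; swap; module PermutationReasoning)
import Data.List.Relation.Binary.Permutation.Propositional.Properties as ↭
open import Data.Nat using (ℕ; zero; suc)
open import Data.Product using (_×_; _,_; proj₁; proj₂)
open import Data.Sum using (inj₁; inj₂)
open import Data.Vec using (_∷_; []; lookup)
open import Function using (_∘_)
open import Relation.Binary.Definitions using (Tri; tri<; tri≈; tri>)
open import Relation.Binary.PropositionalEquality
  using (_≡_; refl; sym; trans; cong; cong₂; subst; subst₂; module ≡-Reasoning)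
open import Relation.Binary.Structures using (IsStrictTotalOrder)
open import Algebra.Bundles using (CommutativeRing)
import Algebra.Properties.Ring as RingProperties
import Algebra.Solver.CommutativeMonoid as CommutativeMonoidSolver
import Algebra.Properties.CommutativeSemigroup as CommutativeSemigroupProperties

module Completeness (R : Reals) where
  open Reals R
  open Syntax R renaming (refl to ≈ₑ-refl; sym to ≈ₑ-sym; trans to ≈ₑ-trans)
  open IsStrictTotalOrder isStrictTotalOrder using (compare; irrefl; asym)

  ℝ-commutativeRing : CommutativeRing 0ℓ 0ℓ
  ℝ-commutativeRing = record { isCommutativeRing = isCommutativeRing }

  module ℝ = CommutativeRing ℝ-commutativeRing
  open RingProperties ℝ.ring using (-‿involutive; -1*x≈-x; -‿distribˡ-*; -‿distribʳ-*)
  open CommutativeMonoidSolver ℝ.*-commutativeMonoid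
    using () renaming (solve to ×-solve; _⊜_ to _≋ₓ_; _⊕_ to _∙_)
  open CommutativeSemigroupProperties ℝ.+-commutativeSemigroup
    using () renaming (interchange to +-interchange)

  x<0⇒0<-x : ∀ {x} → x < 0ℝ → 0ℝ < - x
  x<0⇒0<-x {x} x<0 = subst₂ _<_ (ℝ.-‿inverseʳ x) (ℝ.+-identityˡ (- x)) (+-mono-< (- x) x<0)

  0<1 : 0ℝ < 1ℝ
  0<1 with compare 0ℝ 1ℝ
  ... | tri< 0<1 _ _ = 0<1
  ... | tri≈ _ 0≡1 _ = ⊥-elim (0≢1 0≡1)
  ... | tri> _ _ 1<0 = ⊥-elim (asym 1<0 (subst (0ℝ <_) -1*-1≡1 (*-pos 0<-1 0<-1)))
    where
    0<-1 = x<0⇒0<-x 1<0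
    -1*-1≡1 : - 1ℝ * - 1ℝ ≡ 1ℝ
    -1*-1≡1 = trans (-1*x≈-x (- 1ℝ)) (-‿involutive 1ℝ)

  -1<0 : - 1ℝ < 0ℝ
  -1<0 = subst₂ _<_ (ℝ.+-identityˡ (- 1ℝ)) (ℝ.-‿inverseʳ 1ℝ) (+-mono-< (- 1ℝ) 0<1)

  1ℝ⁺ : ℝ⁺
  1ℝ⁺ = 1ℝ , 0<1

  [1] : List ℝ⁺
  [1] = 1ℝ⁺ ∷ []

  Σ⃗-++ : ∀ xs ys → Σ⃗ (xs ++ ys) ≡ Σ⃗ xs + Σ⃗ ys
  Σ⃗-++ [] ys = sym (ℝ.+-identityˡ _)
  Σ⃗-++ (x ∷ xs) ys = trans (cong (proj₁ x +_) (Σ⃗-++ xs ys)) (sym (ℝ.+-assoc _ _ _))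

  Σ⃗-scaleV : ∀ t rs → Σ⃗ (scaleV t rs) ≡ proj₁ t * Σ⃗ rs
  Σ⃗-scaleV t [] = sym (ℝ.zeroʳ _)
  Σ⃗-scaleV t (r ∷ rs) =
    trans (cong (proj₁ t * proj₁ r +_) (Σ⃗-scaleV t rs)) (sym (ℝ.distribˡ _ _ _))

  ·-++ : ∀ xs ys A → (xs ++ ys) · A ≡ xs · A ++ ys · A
  ·-++ xs ys A = List.map-++ (_, A) xs ys

  neg-involutive : ∀ A → neg (neg A) ≡ A
  neg-involutive (var x) = refl
  neg-involutive (covar x) = refl
  neg-involutive 𝟘 = refl
  neg-involutive (A ⊕ B) = cong₂ _⊕_ (neg-involutive A) (neg-involutive B)
  neg-involutive (r ● A) = cong (r ●_) (neg-involutive A)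
  neg-involutive (A ⊔ B) = cong₂ _⊔_ (neg-involutive A) (neg-involutive B)
  neg-involutive (A ⊓ B) = cong₂ _⊓_ (neg-involutive A) (neg-involutive B)

  open CommutativeMonoidSolver (↭.++-commutativeMonoid {A = WTerm})
    using () renaming (solve to ↭-solve; _⊜_ to _≋_; _⊕_ to _&_)

  ↭-swap-last : ∀ (g a b : Sequent) → (g ++ a) ++ b ↭ (g ++ b) ++ a
  ↭-swap-last = ↭-solve 3 (λ g a b → ((g & a) & b) ≋ ((g & b) & a)) ↭-refl

  ↭-interchange : ∀ (a b c d : Sequent) → (a ++ b) ++ (c ++ d) ↭ (a ++ c) ++ (b ++ d)
  ↭-interchange = ↭-solve 4 (λ a b c d → ((a & b) & (c & d)) ≋ ((a & c) & (b & d))) ↭-refl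

  swapH : ∀ {Γ Δ G} → HR (Γ ∷ Δ ∷ G) → HR (Δ ∷ Γ ∷ G)
  swapH = exH (swap _ _ ↭-refl)

  W₂ : ∀ {Γ Δ G} → HR (Γ ∷ G) → HR (Γ ∷ Δ ∷ G)
  W₂ h = swapH (W h)

  reassoc : ∀ Γ Δ Θ {G} → HR (((Γ ++ Δ) ++ Θ) ∷ G) → HR ((Γ ++ Δ ++ Θ) ∷ G)
  reassoc Γ Δ Θ = exS (↭-reflexive (List.++-assoc Γ Δ Θ))

  unassoc : ∀ Γ Δ Θ {G} → HR ((Γ ++ Δ ++ Θ) ∷ G) → HR (((Γ ++ Δ) ++ Θ) ∷ G)
  unassoc Γ Δ Θ = exS (↭-reflexive (sym (List.++-assoc Γ Δ Θ)))

  Intro : Sequent → Set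
  Intro Δ = ∀ Γ {G} → HR (Γ ∷ G) → HR ((Γ ++ Δ) ∷ G)

  Rule : Sequent → Sequent → Set
  Rule Π Δ = ∀ Γ {G} → HR ((Γ ++ Π) ∷ G) → HR ((Γ ++ Δ) ∷ G)

  Intro-↭ : ∀ {Δ Δ′} → Δ ↭ Δ′ → Intro Δ → Intro Δ′
  Intro-↭ p i Γ h = exS (↭.++⁺ˡ Γ p) (i Γ h)

  Rule-↭ : ∀ {Π Π′ Δ} → Π′ ↭ Π → Rule Π Δ → Rule Π′ Δ
  Rule-↭ p r Γ h = r Γ (exS (↭.++⁺ˡ Γ p) h)

  Intro-rule : ∀ {Π Δ} → Rule Π Δ → Intro Π → Intro Δ
  Intro-rule r i Γ h = r Γ (i Γ h)

  Intro-++ : ∀ {Δ Δ′} → Intro Δ → Intro Δ′ → Intro (Δ ++ Δ′)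
  Intro-++ {Δ} {Δ′} i i′ Γ h = reassoc Γ Δ Δ′ (i′ (Γ ++ Δ) (i Γ h))

  Rule-++ : ∀ {Π Π′ Δ Δ′} → Rule Π Δ → Rule Π′ Δ′ → Rule (Π ++ Π′) (Δ ++ Δ′)
  Rule-++ {Π} {Π′} {Δ} {Δ′} r r′ Γ h =
    exS (↭-trans (↭-swap-last Γ Δ′ Δ) (↭-reflexive (List.++-assoc Γ Δ Δ′)))
      (r (Γ ++ Δ′) (exS (↭-swap-last Γ Π Δ′) (r′ (Γ ++ Π) (unassoc Γ Π Π′ h))))

  Rule-trans : ∀ {Π Δ Θ} → Rule Π Δ → Rule Δ Θ → Rule Π Θ
  Rule-trans r r′ Γ h = r′ Γ (r Γ h)

  Intro⇒Rule : ∀ {Δ} → Intro Δ → Rule [] Δ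
  Intro⇒Rule i Γ h = i Γ (subst (λ Θ → HR (Θ ∷ _)) (List.++-identityʳ Γ) h)

  Rule-++ʳ : ∀ {Π Δ Θ} → Rule Π Δ → Rule (Θ ++ Π) (Θ ++ Δ)
  Rule-++ʳ {Π} {Δ} {Θ} r Γ h = reassoc Γ Θ Δ (r (Γ ++ Θ) (unassoc Γ Θ Π h))

  Rule-++ˡ : ∀ {Π Δ Θ} → Rule Π Δ → Rule (Π ++ Θ) (Δ ++ Θ)
  Rule-++ˡ r = Rule-++ r (λ _ h → h)

  ZEROᵗ : ∀ rs → Intro (rs · 𝟘)
  ZEROᵗ rs Γ = ZERO {Γ = Γ} rs

  PLUSᵗ : ∀ rs A B → Rule (rs · A ++ rs · B) (rs · (A ⊕ B))
  PLUSᵗ rs A B Γ = PLUS {Γ = Γ} rs A B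

  TIMESᵗ : ∀ rs s A → Rule (scaleV s rs · A) (rs · (s ● A))
  TIMESᵗ rs s A Γ = TIMES {Γ = Γ} rs s A

  JOINˡ : ∀ rs A B → Rule (rs · A) (rs · (A ⊔ B))
  JOINˡ rs A B Γ h = JOIN rs A B (W₂ h)

  JOINʳ : ∀ rs A B → Rule (rs · B) (rs · (A ⊔ B))
  JOINʳ rs A B Γ h = JOIN rs A B (W h)

  Intro-MEET : ∀ {Δ} rs A B → Intro (Δ ++ rs · A) → Intro (Δ ++ rs · B) →
               Intro (Δ ++ rs · (A ⊓ B))
  Intro-MEET {Δ} rs A B i j Γ h =
    reassoc Γ Δ _ (MEET rs A B (unassoc Γ Δ _ (i Γ h)) (unassoc Γ Δ _ (j Γ h)))

  Intro-CAN : ∀ {Δ} rs ss A → Σ⃗ rs ≡ Σ⃗ ss → Intro (Δ ++ ss · A ++ rs · neg A) → Intro Δ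
  Intro-CAN {Δ} rs ss A e i Γ h = CAN rs ss A e (unassoc Γ Δ _ (i Γ h))

  -- The derivable order

  infix 4 _⊑_ _⊑⊒_
  _⊑_ : Term → Term → Set
  A ⊑ B = ∀ rs ss → Σ⃗ rs ≡ Σ⃗ ss → Intro (rs · B ++ ss · neg A)

  _⊑⊒_ : Term → Term → Set
  A ⊑⊒ B = (A ⊑ B) × (B ⊑ A)

  ⊑-dual : ∀ {A B} → A ⊑ B → neg B ⊑ neg A
  ⊑-dual {A} {B} A⊑B rs ss e =
    subst (λ X → Intro (rs · neg A ++ ss · X)) (sym (neg-involutive B))
      (Intro-↭ (↭.++-comm (ss · B) (rs · neg A)) (A⊑B ss rs (sym e)))

  ⊑-undual : ∀ {A B} → neg B ⊑ neg A → A ⊑ B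
  ⊑-undual {A} {B} p = subst₂ _⊑_ (neg-involutive A) (neg-involutive B) (⊑-dual p)

  ⊑-trans : ∀ {A B U} → A ⊑ B → B ⊑ U → A ⊑ U
  ⊑-trans {A} {B} {U} A⊑B B⊑U rs ss e =
    Intro-CAN ss ss B refl
      (Intro-↭ (↭-solve 4 (λ b na u nb → ((b & na) & (u & nb)) ≋ ((u & na) & (b & nb))) ↭-refl
                  (ss · B) (ss · neg A) (rs · U) (ss · neg B))
        (Intro-++ (A⊑B ss ss refl) (B⊑U rs ss e)))

  ⊕-mono-⊑ : ∀ {A A′ B B′} → A ⊑ A′ → B ⊑ B′ → A ⊕ B ⊑ A′ ⊕ B′
  ⊕-mono-⊑ {A} {A′} {B} {B′} A⊑A′ B⊑B′ rs ss e =
    Intro-rule (Rule-++ (PLUSᵗ rs A′ B′) (PLUSᵗ ss (neg A) (neg B)))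
      (Intro-↭ (↭-interchange (rs · A′) (ss · neg A) (rs · B′) (ss · neg B))
        (Intro-++ (A⊑A′ rs ss e) (B⊑B′ rs ss e)))

  ●-mono-⊑ : ∀ {A A′} (t t′ : ℝ⁺) → proj₁ t ≡ proj₁ t′ → A ⊑ A′ → t ● A ⊑ t′ ● A′
  ●-mono-⊑ {A} {A′} t t′ t≡t′ A⊑A′ rs ss e =
    Intro-rule (Rule-++ (TIMESᵗ rs t′ A′) (TIMESᵗ ss t (neg A)))
      (A⊑A′ (scaleV t′ rs) (scaleV t ss) scaled-balance)
    where
    open ≡-Reasoning
    scaled-balance : Σ⃗ (scaleV t′ rs) ≡ Σ⃗ (scaleV t ss)
    scaled-balance = begin
      Σ⃗ (scaleV t′ rs)     ≡⟨ Σ⃗-scaleV t′ rs ⟩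
      proj₁ t′ * Σ⃗ rs     ≡⟨ cong₂ _*_ (sym t≡t′) e ⟩
      proj₁ t * Σ⃗ ss      ≡⟨ Σ⃗-scaleV t ss ⟨
      Σ⃗ (scaleV t ss)     ∎

  ⊔-upperˡ : ∀ {A U V} → A ⊑ U → A ⊑ U ⊔ V
  ⊔-upperˡ {U = U} {V} A⊑U rs ss e = Intro-rule (Rule-++ˡ (JOINˡ rs U V)) (A⊑U rs ss e)

  ⊔-upperʳ : ∀ {A U V} → A ⊑ V → A ⊑ U ⊔ V
  ⊔-upperʳ {U = U} {V} A⊑V rs ss e = Intro-rule (Rule-++ˡ (JOINʳ rs U V)) (A⊑V rs ss e)

  ⊔-least : ∀ {A B U} → A ⊑ U → B ⊑ U → A ⊔ B ⊑ U
  ⊔-least {A} {B} A⊑U B⊑U rs ss e = Intro-MEET ss (neg A) (neg B) (A⊑U rs ss e) (B⊑U rs ss e)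

  ⊓-lowerˡ : ∀ {A B U} → U ⊑ A → U ⊓ B ⊑ A
  ⊓-lowerˡ p = ⊑-undual (⊔-upperˡ (⊑-dual p))

  ⊓-lowerʳ : ∀ {A B U} → U ⊑ B → A ⊓ U ⊑ B
  ⊓-lowerʳ p = ⊑-undual (⊔-upperʳ (⊑-dual p))

  ⊓-greatest : ∀ {A B U} → U ⊑ A → U ⊑ B → U ⊑ A ⊓ B
  ⊓-greatest p q = ⊑-undual (⊔-least (⊑-dual p) (⊑-dual q))

  ⊔-mono-⊑ : ∀ {A A′ B B′} → A ⊑ A′ → B ⊑ B′ → A ⊔ B ⊑ A′ ⊔ B′
  ⊔-mono-⊑ p q = ⊔-least (⊔-upperˡ p) (⊔-upperʳ q)

  ⊓-mono-⊑ : ∀ {A A′ B B′} → A ⊑ A′ → B ⊑ B′ → A ⊓ B ⊑ A′ ⊓ B′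
  ⊓-mono-⊑ p q = ⊓-greatest (⊓-lowerˡ p) (⊓-lowerʳ q)

  var-⊑ : ∀ x → var x ⊑ var x
  var-⊑ x rs ss e Γ = ID {Γ = Γ} rs ss x e

  generalised-ID : ∀ A → A ⊑ A
  generalised-ID (var x)   = var-⊑ x
  generalised-ID (covar x) = ⊑-dual (var-⊑ x)
  generalised-ID 𝟘 rs ss e = Intro-++ (ZEROᵗ rs) (ZEROᵗ ss)
  generalised-ID (A ⊕ B)   = ⊕-mono-⊑ (generalised-ID A) (generalised-ID B)
  generalised-ID (t ● A)   = ●-mono-⊑ t t refl (generalised-ID A)
  generalised-ID (A ⊔ B)   = ⊔-mono-⊑ (generalised-ID A) (generalised-ID B)
  generalised-ID (A ⊓ B)   = ⊓-mono-⊑ (generalised-ID A) (generalised-ID B)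

  ⊑-refl : ∀ {A} → A ⊑ A
  ⊑-refl = generalised-ID _

  -- Negation normal forms and linear combinations

  -- HR has only positive scalars: c • X becomes 0 for c = 0 and (−c)·X̄ for c < 0.
  scaleTri : (c : ℝ) → Tri (0ℝ < c) (0ℝ ≡ c) (c < 0ℝ) → Term → Term
  scaleTri c (tri< 0<c _ _) X = (c , 0<c) ● X
  scaleTri c (tri≈ _ _ _)   X = 𝟘
  scaleTri c (tri> _ _ c<0) X = (- c , x<0⇒0<-x c<0) ● neg X

  scaleTerm : ℝ → Term → Term
  scaleTerm c = scaleTri c (compare 0ℝ c)

  nnf : RTerm → Term
  nnf (v x)    = var x
  nnf 0ᵗ       = 𝟘
  nnf (a +ᵗ b) = nnf a ⊕ nnf b
  nnf (r • a)  = scaleTerm r (nnf a)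
  nnf (a ∨ b)  = nnf a ⊔ nnf b
  nnf (a ∧ b)  = nnf a ⊓ nnf b

  infixl 6 _⊞_
  infixr 7 _⊡_
  data Lin (n : ℕ) : Set where
    atom : Fin n → Lin n
    none : Lin n
    _⊞_  : Lin n → Lin n → Lin n
    _⊡_  : ℝ → Lin n → Lin n

  ⟦_⟧ₗ : ∀ {n} → Lin n → (Fin n → Term) → Term
  ⟦ atom j ⟧ₗ env = env j
  ⟦ none ⟧ₗ   env = 𝟘
  ⟦ l ⊞ m ⟧ₗ  env = ⟦ l ⟧ₗ env ⊕ ⟦ m ⟧ₗ env
  ⟦ c ⊡ l ⟧ₗ  env = scaleTerm c (⟦ l ⟧ₗ env)

  δ : ∀ {n} → Fin n → Fin n → ℝ
  δ zero    zero    = 1ℝ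
  δ zero    (suc i) = 0ℝ
  δ (suc j) zero    = 0ℝ
  δ (suc j) (suc i) = δ j i

  coeff : ∀ {n} → Lin n → Fin n → ℝ
  coeff (atom j) = δ j
  coeff none     i = 0ℝ
  coeff (l ⊞ m)  i = coeff l i + coeff m i
  coeff (c ⊡ l)  i = c * coeff l i

  Weights : ℕ → Set
  Weights n = Fin n → List ℝ⁺

  noWeights : ∀ {n} → Weights n
  noWeights _ = []

  weightsAt : ∀ {n} → Fin n → List ℝ⁺ → Weights n
  weightsAt zero    rs zero    = rs
  weightsAt zero    rs (suc i) = []
  weightsAt (suc j) rs zero    = []
  weightsAt (suc j) rs (suc i) = weightsAt j rs i

  Σ⃗-weightsAt : ∀ {n} (j i : Fin n) rs → Σ⃗ (weightsAt j rs i) ≡ δ j i * Σ⃗ rs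
  Σ⃗-weightsAt zero    zero    rs = sym (ℝ.*-identityˡ _)
  Σ⃗-weightsAt zero    (suc i) rs = sym (ℝ.zeroˡ _)
  Σ⃗-weightsAt (suc j) zero    rs = sym (ℝ.zeroˡ _)
  Σ⃗-weightsAt (suc j) (suc i) rs = Σ⃗-weightsAt j i rs

  literals : ∀ {n} → (Fin n → Term) → Weights n → Weights n → Sequent
  literals {zero}  env P N = []
  literals {suc n} env P N =
    (P zero · env zero ++ N zero · neg (env zero)) ++ literals (env ∘ suc) (P ∘ suc) (N ∘ suc)

  literals-none : ∀ {n} (env : Fin n → Term) → literals env noWeights noWeights ≡ []
  literals-none {zero}  env = refl
  literals-none {suc n} env = literals-none (env ∘ suc)

  literals-++ : ∀ {n} (env : Fin n → Term) P N P′ N′ →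
                literals env (λ i → P i ++ P′ i) (λ i → N i ++ N′ i) ↭
                literals env P N ++ literals env P′ N′
  literals-++ {zero}  env P N P′ N′ = ↭-refl
  literals-++ {suc n} env P N P′ N′ = begin
    ((P zero ++ P′ zero) · A ++ (N zero ++ N′ zero) · neg A) ++ rest
      ≡⟨ cong₂ (λ x y → (x ++ y) ++ rest) (·-++ (P zero) (P′ zero) A)
                                           (·-++ (N zero) (N′ zero) (neg A)) ⟩
    ((P zero · A ++ P′ zero · A) ++ (N zero · neg A ++ N′ zero · neg A)) ++ rest
      ↭⟨ ↭.++⁺ˡ _ (literals-++ (env ∘ suc) (P ∘ suc) (N ∘ suc) (P′ ∘ suc) (N′ ∘ suc)) ⟩
    ((P zero · A ++ P′ zero · A) ++ (N zero · neg A ++ N′ zero · neg A)) ++ (L ++ L′)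
      ↭⟨ ↭-solve 6 (λ a a′ b b′ c c′ → (((a & a′) & (b & b′)) & (c & c′)) ≋
                                         (((a & b) & c) & ((a′ & b′) & c′))) ↭-refl
           (P zero · A) (P′ zero · A) (N zero · neg A) (N′ zero · neg A) L L′ ⟩
    ((P zero · A ++ N zero · neg A) ++ L) ++ ((P′ zero · A ++ N′ zero · neg A) ++ L′) ∎
    where
    open PermutationReasoning
    A = env zero
    rest = literals (env ∘ suc) (λ i → P (suc i) ++ P′ (suc i)) (λ i → N (suc i) ++ N′ (suc i))
    L = literals (env ∘ suc) (P ∘ suc) (N ∘ suc)
    L′ = literals (env ∘ suc) (P′ ∘ suc) (N′ ∘ suc)

  literals-weightsAtᴾ : ∀ {n} (env : Fin n → Term) j rs →
                        literals env (weightsAt j rs) noWeights ↭ rs · env j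
  literals-weightsAtᴾ {suc n} env zero rs = ↭-reflexive (begin
    (rs · env zero ++ []) ++ literals (env ∘ suc) noWeights noWeights
      ≡⟨ cong₂ _++_ (List.++-identityʳ (rs · env zero)) (literals-none (env ∘ suc)) ⟩
    rs · env zero ++ []   ≡⟨ List.++-identityʳ _ ⟩
    rs · env zero         ∎)
    where open ≡-Reasoning
  literals-weightsAtᴾ {suc n} env (suc j) rs = literals-weightsAtᴾ (env ∘ suc) j rs

  literals-weightsAtᴺ : ∀ {n} (env : Fin n → Term) j rs →
                        literals env noWeights (weightsAt j rs) ↭ rs · neg (env j)
  literals-weightsAtᴺ {suc n} env zero rs = ↭-reflexive
    (trans (cong (rs · neg (env zero) ++_) (literals-none (env ∘ suc))) (List.++-identityʳ _))
  literals-weightsAtᴺ {suc n} env (suc j) rs = literals-weightsAtᴺ (env ∘ suc) j rs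

  literals-balanced : ∀ {n} (env : Fin n → Term) P N → (∀ i → Σ⃗ (P i) ≡ Σ⃗ (N i)) →
                      Intro (literals env P N)
  literals-balanced {zero}  env P N e Γ = subst (λ Δ → HR (Δ ∷ _)) (sym (List.++-identityʳ Γ))
  literals-balanced {suc n} env P N e =
    Intro-++ (generalised-ID (env zero) (P zero) (N zero) (e zero))
             (literals-balanced (env ∘ suc) (P ∘ suc) (N ∘ suc) (e ∘ suc))

  σ : Bool → ℝ
  σ true  = 1ℝ
  σ false = - 1ℝ

  σ-not : ∀ b → σ (not b) ≡ - σ b
  σ-not true  = refl
  σ-not false = sym (-‿involutive 1ℝ)

  pol : Bool → Term → Term
  pol true  X = X
  pol false X = neg X

  pol-𝟘 : ∀ b → pol b 𝟘 ≡ 𝟘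
  pol-𝟘 true  = refl
  pol-𝟘 false = refl

  pol-⊕ : ∀ b X Y → pol b (X ⊕ Y) ≡ pol b X ⊕ pol b Y
  pol-⊕ true  X Y = refl
  pol-⊕ false X Y = refl

  pol-● : ∀ b t X → pol b (t ● X) ≡ t ● pol b X
  pol-● true  t X = refl
  pol-● false t X = refl

  pol-neg : ∀ b X → pol b (neg X) ≡ pol (not b) X
  pol-neg true  X = refl
  pol-neg false X = neg-involutive X

  -- Unfolding rs.X (rs.X̄ if b = false) leaves literals whose weights on env i and on its
  -- negation differ by σ b · K i · Σ rs, where K is the coefficient vector of X.
  record Expansion {n} (env : Fin n → Term) (X : Term) (K : Fin n → ℝ) (b : Bool) (rs : List ℝ⁺) :
                   Set where
    field
      P N     : Weights n
      balance : ∀ i → Σ⃗ (P i) ≡ Σ⃗ (N i) + (σ b * K i) * Σ⃗ rs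
      unfold  : Rule (literals env P N) (rs · pol b X)

  atomᴾ-balance : ∀ {x} d s → x ≡ d * s → x ≡ 0ℝ + (1ℝ * d) * s
  atomᴾ-balance d s x≡ds = trans x≡ds (sym (trans (ℝ.+-identityˡ _) (cong (_* s) (ℝ.*-identityˡ d))))

  atomᴺ-balance : ∀ {x} d s → x ≡ d * s → 0ℝ ≡ x + (- 1ℝ * d) * s
  atomᴺ-balance d s refl = sym (begin
    d * s + (- 1ℝ * d) * s  ≡⟨ cong (λ y → d * s + y * s) (-1*x≈-x d) ⟩
    d * s + (- d) * s       ≡⟨ ℝ.distribʳ s d (- d) ⟨
    (d + - d) * s           ≡⟨ cong (_* s) (ℝ.-‿inverseʳ d) ⟩
    0ℝ * s                  ≡⟨ ℝ.zeroˡ s ⟩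
    0ℝ                      ∎)
    where open ≡-Reasoning

  zero-balance : ∀ x k s → k ≡ 0ℝ → 0ℝ ≡ 0ℝ + (x * k) * s
  zero-balance x k s refl = sym (begin
    0ℝ + (x * 0ℝ) * s  ≡⟨ ℝ.+-identityˡ _ ⟩
    (x * 0ℝ) * s       ≡⟨ cong (_* s) (ℝ.zeroʳ x) ⟩
    0ℝ * s             ≡⟨ ℝ.zeroˡ s ⟩
    0ℝ                 ∎)
    where open ≡-Reasoning

  sum-balance : ∀ {p₁ p₂} n₁ n₂ x k₁ k₂ s → p₁ ≡ n₁ + (x * k₁) * s → p₂ ≡ n₂ + (x * k₂) * s →
                p₁ + p₂ ≡ (n₁ + n₂) + (x * (k₁ + k₂)) * s
  sum-balance n₁ n₂ x k₁ k₂ s refl refl = begin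
    (n₁ + (x * k₁) * s) + (n₂ + (x * k₂) * s)  ≡⟨ +-interchange n₁ _ n₂ _ ⟩
    (n₁ + n₂) + ((x * k₁) * s + (x * k₂) * s)  ≡⟨ cong ((n₁ + n₂) +_) (ℝ.distribʳ s _ _) ⟨
    (n₁ + n₂) + (x * k₁ + x * k₂) * s          ≡⟨ cong (λ y → (n₁ + n₂) + y * s) (ℝ.distribˡ x k₁ k₂) ⟨
    (n₁ + n₂) + (x * (k₁ + k₂)) * s            ∎
    where open ≡-Reasoning

  *-rearrange : ∀ x k c s → (x * k) * (c * s) ≡ (x * (c * k)) * s
  *-rearrange = ×-solve 4 (λ x k c s → ((x ∙ k) ∙ (c ∙ s)) ≋ₓ ((x ∙ (c ∙ k)) ∙ s)) refl

  -x*-y≡x*y : ∀ x y → - x * - y ≡ x * y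
  -x*-y≡x*y x y = begin
    - x * - y      ≡⟨ -‿distribˡ-* x (- y) ⟨
    - (x * - y)    ≡⟨ cong -_ (-‿distribʳ-* x y) ⟨
    - (- (x * y))  ≡⟨ -‿involutive (x * y) ⟩
    x * y          ∎
    where open ≡-Reasoning

  scale-balance : ∀ {p} n x k c s → p ≡ n + (x * k) * (c * s) → p ≡ n + (x * (c * k)) * s
  scale-balance n x k c s p≡ = trans p≡ (cong (n +_) (*-rearrange x k c s))

  flip-balance : ∀ {p} n x k c s → p ≡ n + (- x * k) * (- c * s) → p ≡ n + (x * (c * k)) * s
  flip-balance n x k c s p≡ = trans p≡ (cong (n +_) (begin
    (- x * k) * (- c * s)      ≡⟨ cong₂ _*_ (-‿distribˡ-* x k) (-‿distribˡ-* c s) ⟨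
    - (x * k) * - (c * s)      ≡⟨ -x*-y≡x*y (x * k) (c * s) ⟩
    (x * k) * (c * s)          ≡⟨ *-rearrange x k c s ⟩
    (x * (c * k)) * s          ∎))
    where open ≡-Reasoning

  cancel-balance : ∀ {p₁ p₂} n₁ n₂ x k s → p₁ ≡ n₁ + (x * k) * s → p₂ ≡ n₂ + (- x * k) * s →
                   p₁ + p₂ ≡ n₁ + n₂
  cancel-balance n₁ n₂ x k s refl refl = begin
    (n₁ + a) + (n₂ + (- x * k) * s)  ≡⟨ cong (λ y → (n₁ + a) + (n₂ + y * s)) (-‿distribˡ-* x k) ⟨
    (n₁ + a) + (n₂ + - (x * k) * s)  ≡⟨ cong (λ y → (n₁ + a) + (n₂ + y)) (-‿distribˡ-* (x * k) s) ⟨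
    (n₁ + a) + (n₂ + - a)            ≡⟨ +-interchange n₁ a n₂ (- a) ⟩
    (n₁ + n₂) + (a + - a)            ≡⟨ cong ((n₁ + n₂) +_) (ℝ.-‿inverseʳ a) ⟩
    (n₁ + n₂) + 0ℝ                   ≡⟨ ℝ.+-identityʳ _ ⟩
    n₁ + n₂                          ∎
    where
    open ≡-Reasoning
    a = (x * k) * s

  expansion-𝟘 : ∀ {n} (env : Fin n → Term) K b rs → (∀ i → K i ≡ 0ℝ) → Expansion env 𝟘 K b rs
  expansion-𝟘 env K b rs K≡0 = record
    { P       = noWeights
    ; N       = noWeights
    ; balance = λ i → zero-balance (σ b) (K i) (Σ⃗ rs) (K≡0 i)
    ; unfold  = subst (λ X → Rule _ (rs · X)) (sym (pol-𝟘 b))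
                  (Rule-↭ (↭-reflexive (literals-none env)) (Intro⇒Rule (ZEROᵗ rs)))
    }

  expansion-⊕ : ∀ {n} {env : Fin n → Term} {X Y K K′ b rs} →
                Expansion env X K b rs → Expansion env Y K′ b rs →
                Expansion env (X ⊕ Y) (λ i → K i + K′ i) b rs
  expansion-⊕ {env = env} {X} {Y} {K} {K′} {b} {rs} E F = record
    { P       = λ i → E.P i ++ F.P i
    ; N       = λ i → E.N i ++ F.N i
    ; balance = λ i → trans (Σ⃗-++ (E.P i) (F.P i))
                  (trans (sum-balance _ _ (σ b) (K i) (K′ i) (Σ⃗ rs) (E.balance i) (F.balance i))
                    (cong (_+ _) (sym (Σ⃗-++ (E.N i) (F.N i)))))
    ; unfold  = subst (λ Z → Rule _ (rs · Z)) (sym (pol-⊕ b X Y))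
                  (Rule-↭ (literals-++ env E.P E.N F.P F.N)
                    (Rule-trans (Rule-++ E.unfold F.unfold) (PLUSᵗ rs (pol b X) (pol b Y))))
    }
    where
    module E = Expansion E
    module F = Expansion F

  expansion-scale : ∀ {n} {env : Fin n → Term} {X K} c (tr : Tri (0ℝ < c) (0ℝ ≡ c) (c < 0ℝ)) →
                    (∀ b rs → Expansion env X K b rs) →
                    ∀ b rs → Expansion env (scaleTri c tr X) (λ i → c * K i) b rs
  expansion-scale {env = env} {X} {K} c (tri< 0<c _ _) E b rs = record
    { P       = E′.P
    ; N       = E′.N
    ; balance = λ i → scale-balance _ (σ b) (K i) c (Σ⃗ rs)
                  (trans (E′.balance i) (cong (λ y → Σ⃗ (E′.N i) + (σ b * K i) * y) (Σ⃗-scaleV c⁺ rs)))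
    ; unfold  = subst (λ Z → Rule (literals env E′.P E′.N) (rs · Z)) (sym (pol-● b c⁺ X))
                  (Rule-trans E′.unfold (TIMESᵗ rs c⁺ (pol b X)))
    }
    where
    c⁺ = c , 0<c
    module E′ = Expansion (E b (scaleV c⁺ rs))
  expansion-scale {env = env} {K = K} c (tri≈ _ 0≡c _) E b rs =
    expansion-𝟘 env _ b rs (λ i → trans (cong (_* K i) (sym 0≡c)) (ℝ.zeroˡ (K i)))
  expansion-scale {env = env} {X} {K} c (tri> _ _ c<0) E b rs = record
    { P       = E′.P
    ; N       = E′.N
    ; balance = λ i → flip-balance _ (σ b) (K i) c (Σ⃗ rs)
                  (trans (E′.balance i)
                    (cong₂ (λ x y → Σ⃗ (E′.N i) + (x * K i) * y) (σ-not b) (Σ⃗-scaleV c⁻ rs)))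
    ; unfold  = subst (λ Z → Rule (literals env E′.P E′.N) (rs · Z)) (sym pol-c⁻X)
                  (Rule-trans E′.unfold (TIMESᵗ rs c⁻ (pol (not b) X)))
    }
    where
    c⁻ = - c , x<0⇒0<-x c<0
    module E′ = Expansion (E (not b) (scaleV c⁻ rs))
    pol-c⁻X : pol b (c⁻ ● neg X) ≡ c⁻ ● pol (not b) X
    pol-c⁻X = trans (pol-● b c⁻ (neg X)) (cong (c⁻ ●_) (pol-neg b X))

  expand : ∀ {n} (env : Fin n → Term) (l : Lin n) b rs → Expansion env (⟦ l ⟧ₗ env) (coeff l) b rs
  expand env (atom j) true rs = record
    { P       = weightsAt j rs
    ; N       = noWeights
    ; balance = λ i → atomᴾ-balance (δ j i) (Σ⃗ rs) (Σ⃗-weightsAt j i rs)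
    ; unfold  = Rule-↭ (literals-weightsAtᴾ env j rs) (λ _ h → h)
    }
  expand env (atom j) false rs = record
    { P       = noWeights
    ; N       = weightsAt j rs
    ; balance = λ i → atomᴺ-balance (δ j i) (Σ⃗ rs) (Σ⃗-weightsAt j i rs)
    ; unfold  = Rule-↭ (literals-weightsAtᴺ env j rs) (λ _ h → h)
    }
  expand env none    b rs = expansion-𝟘 env (λ _ → 0ℝ) b rs (λ _ → refl)
  expand env (l ⊞ m) b rs = expansion-⊕ (expand env l b rs) (expand env m b rs)
  expand env (c ⊡ l) b rs = expansion-scale c (compare 0ℝ c) (expand env l) b rs

  coeff-⊑ : ∀ {n} (env : Fin n → Term) (l₁ l₂ : Lin n) → (∀ i → coeff l₁ i ≡ coeff l₂ i) →
            ⟦ l₁ ⟧ₗ env ⊑ ⟦ l₂ ⟧ₗ env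
  coeff-⊑ env l₁ l₂ same rs ss e =
    Intro-rule (Rule-++ E₂.unfold E₁.unfold)
      (Intro-↭ (literals-++ env E₂.P E₂.N E₁.P E₁.N) (literals-balanced env _ _ balanced))
    where
    module E₂ = Expansion (expand env l₂ true rs)
    module E₁ = Expansion (expand env l₁ false ss)
    balanced : ∀ i → Σ⃗ (E₂.P i ++ E₁.P i) ≡ Σ⃗ (E₂.N i ++ E₁.N i)
    balanced i = trans (Σ⃗-++ (E₂.P i) (E₁.P i))
      (trans (cancel-balance _ _ 1ℝ (coeff l₂ i) (Σ⃗ rs) (E₂.balance i)
               (trans (E₁.balance i) (cong₂ (λ k s → _ + (- 1ℝ * k) * s) (same i) (sym e))))
        (sym (Σ⃗-++ (E₂.N i) (E₁.N i))))

  coeff-⊑⊒ : ∀ {n} (env : Fin n → Term) (l₁ l₂ : Lin n) → (∀ i → coeff l₁ i ≡ coeff l₂ i) →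
             ⟦ l₁ ⟧ₗ env ⊑⊒ ⟦ l₂ ⟧ₗ env
  coeff-⊑⊒ env l₁ l₂ same = coeff-⊑ env l₁ l₂ same , coeff-⊑ env l₂ l₁ (sym ∘ same)

  -- Soundness of the Riesz-space axioms

  scaleTri-cong : ∀ c tr {X Y} → X ⊑⊒ Y → scaleTri c tr X ⊑ scaleTri c tr Y
  scaleTri-cong c (tri< 0<c _ _) (X⊑Y , _) = ●-mono-⊑ (c , 0<c) (c , 0<c) refl X⊑Y
  scaleTri-cong c (tri≈ _ _ _)   _         = ⊑-refl
  scaleTri-cong c (tri> _ _ c<0) (_ , Y⊑X) = ●-mono-⊑ c⁻ c⁻ refl (⊑-dual Y⊑X)
    where c⁻ = - c , x<0⇒0<-x c<0

  scaleTri-mono : ∀ c tr → 0ℝ ≤ c → ∀ {X Y} → X ⊑ Y → scaleTri c tr X ⊑ scaleTri c tr Y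
  scaleTri-mono c (tri< 0<c _ _) _         X⊑Y = ●-mono-⊑ (c , 0<c) (c , 0<c) refl X⊑Y
  scaleTri-mono c (tri≈ _ _ _)   _         X⊑Y = ⊑-refl
  scaleTri-mono c (tri> _ _ c<0) (inj₁ 0<c) X⊑Y = ⊥-elim (asym 0<c c<0)
  scaleTri-mono c (tri> _ _ c<0) (inj₂ 0≡c) X⊑Y = ⊥-elim (irrefl (sym 0≡c) c<0)

  a₀ : ∀ {n} → Lin (suc n)
  a₀ = atom zero

  a₁ : ∀ {n} → Lin (suc (suc n))
  a₁ = atom (suc zero)

  a₂ : ∀ {n} → Lin (suc (suc (suc n)))
  a₂ = atom (suc (suc zero))

  axiom-⊑⊒ : ∀ {a b} → Axiom a b → nnf a ⊑⊒ nnf b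
  axiom-⊑⊒ (+-assoc a b c) = coeff-⊑⊒ (lookup (nnf a ∷ nnf b ∷ nnf c ∷ []))
    (a₀ ⊞ (a₁ ⊞ a₂)) ((a₀ ⊞ a₁) ⊞ a₂) (λ i → sym (ℝ.+-assoc _ _ _))
  axiom-⊑⊒ (+-comm a b) = coeff-⊑⊒ (lookup (nnf a ∷ nnf b ∷ []))
    (a₀ ⊞ a₁) (a₁ ⊞ a₀) (λ i → ℝ.+-comm _ _)
  axiom-⊑⊒ (+-idʳ a) = coeff-⊑⊒ (lookup (nnf a ∷ []))
    (a₀ ⊞ none) a₀ (λ i → ℝ.+-identityʳ _)
  axiom-⊑⊒ (+-invʳ a) = coeff-⊑⊒ (lookup (nnf a ∷ []))
    (a₀ ⊞ - 1ℝ ⊡ a₀) none (λ i → trans (cong (δ zero i +_) (-1*x≈-x _)) (ℝ.-‿inverseʳ _))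
  axiom-⊑⊒ (•-assoc r s a) = coeff-⊑⊒ (lookup (nnf a ∷ []))
    (r ⊡ s ⊡ a₀) ((r * s) ⊡ a₀) (λ i → sym (ℝ.*-assoc _ _ _))
  axiom-⊑⊒ (•-one a) = coeff-⊑⊒ (lookup (nnf a ∷ []))
    (1ℝ ⊡ a₀) a₀ (λ i → ℝ.*-identityˡ _)
  axiom-⊑⊒ (•-distˡ r a b) = coeff-⊑⊒ (lookup (nnf a ∷ nnf b ∷ []))
    (r ⊡ (a₀ ⊞ a₁)) (r ⊡ a₀ ⊞ r ⊡ a₁) (λ i → ℝ.distribˡ _ _ _)
  axiom-⊑⊒ (•-distʳ r s a) = coeff-⊑⊒ (lookup (nnf a ∷ []))
    ((r + s) ⊡ a₀) (r ⊡ a₀ ⊞ s ⊡ a₀) (λ i → ℝ.distribʳ _ _ _)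
  axiom-⊑⊒ (∨-assoc a b c) =
      ⊔-least (⊔-upperˡ (⊔-upperˡ ⊑-refl)) (⊔-least (⊔-upperˡ (⊔-upperʳ ⊑-refl)) (⊔-upperʳ ⊑-refl))
    , ⊔-least (⊔-least (⊔-upperˡ ⊑-refl) (⊔-upperʳ (⊔-upperˡ ⊑-refl))) (⊔-upperʳ (⊔-upperʳ ⊑-refl))
  axiom-⊑⊒ (∧-assoc a b c) =
      ⊓-greatest (⊓-greatest (⊓-lowerˡ ⊑-refl) (⊓-lowerʳ (⊓-lowerˡ ⊑-refl))) (⊓-lowerʳ (⊓-lowerʳ ⊑-refl))
    , ⊓-greatest (⊓-lowerˡ (⊓-lowerˡ ⊑-refl)) (⊓-greatest (⊓-lowerˡ (⊓-lowerʳ ⊑-refl)) (⊓-lowerʳ ⊑-refl))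
  axiom-⊑⊒ (∨-comm a b) =
    ⊔-least (⊔-upperʳ ⊑-refl) (⊔-upperˡ ⊑-refl) , ⊔-least (⊔-upperʳ ⊑-refl) (⊔-upperˡ ⊑-refl)
  axiom-⊑⊒ (∧-comm a b) =
    ⊓-greatest (⊓-lowerʳ ⊑-refl) (⊓-lowerˡ ⊑-refl) , ⊓-greatest (⊓-lowerʳ ⊑-refl) (⊓-lowerˡ ⊑-refl)
  axiom-⊑⊒ (∨-absorb a b) = ⊔-least ⊑-refl (⊓-lowerˡ ⊑-refl) , ⊔-upperˡ ⊑-refl
  axiom-⊑⊒ (∧-absorb a b) = ⊓-lowerˡ ⊑-refl , ⊓-greatest ⊑-refl (⊔-upperˡ ⊑-refl)
  axiom-⊑⊒ (∨-idem a) = ⊔-least ⊑-refl ⊑-refl , ⊔-upperˡ ⊑-refl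
  axiom-⊑⊒ (∧-idem a) = ⊓-lowerˡ ⊑-refl , ⊓-greatest ⊑-refl ⊑-refl
  axiom-⊑⊒ (+-compat a b c) =
    ⊓-lowerˡ ⊑-refl , ⊓-greatest ⊑-refl (⊕-mono-⊑ (⊓-lowerʳ ⊑-refl) ⊑-refl)
  axiom-⊑⊒ (•-compat r a b 0≤r) =
    ⊓-lowerˡ ⊑-refl , ⊓-greatest ⊑-refl (scaleTri-mono r (compare 0ℝ r) 0≤r (⊓-lowerʳ ⊑-refl))

  ≈ₑ⇒⊑⊒ : ∀ {a b} → a ≈ₑ b → nnf a ⊑⊒ nnf b
  ≈ₑ⇒⊑⊒ (ax axiom)   = axiom-⊑⊒ axiom
  ≈ₑ⇒⊑⊒ ≈ₑ-refl      = ⊑-refl , ⊑-refl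
  ≈ₑ⇒⊑⊒ (≈ₑ-sym p)   = let a⊑b , b⊑a = ≈ₑ⇒⊑⊒ p in b⊑a , a⊑b
  ≈ₑ⇒⊑⊒ (≈ₑ-trans p q) =
    let a⊑b , b⊑a = ≈ₑ⇒⊑⊒ p ; b⊑c , c⊑b = ≈ₑ⇒⊑⊒ q in
    ⊑-trans a⊑b b⊑c , ⊑-trans c⊑b b⊑a
  ≈ₑ⇒⊑⊒ (+-cong p q) =
    let p₁ , p₂ = ≈ₑ⇒⊑⊒ p ; q₁ , q₂ = ≈ₑ⇒⊑⊒ q in ⊕-mono-⊑ p₁ q₁ , ⊕-mono-⊑ p₂ q₂
  ≈ₑ⇒⊑⊒ (•-cong r p) =
    let p₁ , p₂ = ≈ₑ⇒⊑⊒ p in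
    scaleTri-cong r (compare 0ℝ r) (p₁ , p₂) , scaleTri-cong r (compare 0ℝ r) (p₂ , p₁)
  ≈ₑ⇒⊑⊒ (∨-cong p q) =
    let p₁ , p₂ = ≈ₑ⇒⊑⊒ p ; q₁ , q₂ = ≈ₑ⇒⊑⊒ q in ⊔-mono-⊑ p₁ q₁ , ⊔-mono-⊑ p₂ q₂
  ≈ₑ⇒⊑⊒ (∧-cong p q) =
    let p₁ , p₂ = ≈ₑ⇒⊑⊒ p ; q₁ , q₂ = ≈ₑ⇒⊑⊒ q in ⊓-mono-⊑ p₁ q₁ , ⊓-mono-⊑ p₂ q₂

  -- From ⊢ 1.⟦G⟧ back to G

  ●-one-⊑ : ∀ (t : ℝ⁺) Z → proj₁ t ≡ 1ℝ → t ● Z ⊑ Z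
  ●-one-⊑ t Z t≡1 rs ss e =
    Intro-rule (Rule-++ʳ (TIMESᵗ ss t (neg Z)))
      (generalised-ID Z rs (scaleV t ss) (trans e (sym ss-unchanged)))
    where
    ss-unchanged : Σ⃗ (scaleV t ss) ≡ Σ⃗ ss
    ss-unchanged = trans (Σ⃗-scaleV t ss) (trans (cong (_* Σ⃗ ss) t≡1) (ℝ.*-identityˡ _))

  nnf-covar-⊑ : ∀ x (tr : Tri (0ℝ < - 1ℝ) (0ℝ ≡ - 1ℝ) (- 1ℝ < 0ℝ)) →
                scaleTri (- 1ℝ) tr (var x) ⊑ covar x
  nnf-covar-⊑ x (tri< _ _ -1≮0) = ⊥-elim (-1≮0 -1<0)
  nnf-covar-⊑ x (tri≈ _ _ -1≮0) = ⊥-elim (-1≮0 -1<0)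
  nnf-covar-⊑ x (tri> _ _ _)    = ●-one-⊑ _ (covar x) (-‿involutive 1ℝ)

  nnf-●-⊑ : ∀ (r : ℝ⁺) tr {Y A} → Y ⊑ A → scaleTri (proj₁ r) tr Y ⊑ r ● A
  nnf-●-⊑ r (tri< 0<r _ _) Y⊑A = ●-mono-⊑ (proj₁ r , 0<r) r refl Y⊑A
  nnf-●-⊑ r (tri≈ 0≮r _ _) Y⊑A = ⊥-elim (0≮r (proj₂ r))
  nnf-●-⊑ r (tri> 0≮r _ _) Y⊑A = ⊥-elim (0≮r (proj₂ r))

  nnf-⟦⟧-⊑ : ∀ A → nnf ⟦ A ⟧ᵗ ⊑ A
  nnf-⟦⟧-⊑ (var x)   = ⊑-refl
  nnf-⟦⟧-⊑ (covar x) = nnf-covar-⊑ x (compare 0ℝ (- 1ℝ))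
  nnf-⟦⟧-⊑ 𝟘         = ⊑-refl
  nnf-⟦⟧-⊑ (A ⊕ B)   = ⊕-mono-⊑ (nnf-⟦⟧-⊑ A) (nnf-⟦⟧-⊑ B)
  nnf-⟦⟧-⊑ (r ● A)   = nnf-●-⊑ r (compare 0ℝ (proj₁ r)) (nnf-⟦⟧-⊑ A)
  nnf-⟦⟧-⊑ (A ⊔ B)   = ⊔-mono-⊑ (nnf-⟦⟧-⊑ A) (nnf-⟦⟧-⊑ B)
  nnf-⟦⟧-⊑ (A ⊓ B)   = ⊓-mono-⊑ (nnf-⟦⟧-⊑ A) (nnf-⟦⟧-⊑ B)

  INIT⁺ : ∀ K → HR ([] ∷ K)
  INIT⁺ []      = INIT
  INIT⁺ (Δ ∷ K) = W₂ (INIT⁺ K)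

  𝟘⊑⇒Intro : ∀ {X} → 𝟘 ⊑ X → Intro ([1] · X)
  𝟘⊑⇒Intro {X} 𝟘⊑X = Intro-CAN [1] [1] 𝟘 refl
    (Intro-↭ (↭-reflexive (List.++-assoc ([1] · X) ([1] · 𝟘) ([1] · 𝟘)))
      (Intro-++ (𝟘⊑X [1] [1] refl) (ZEROᵗ [1])))

  cut : ∀ {Θ Δ G} X → HR ((Θ ++ [1] · X) ∷ G) → HR (([1] · neg X ++ Δ) ∷ G) → HR ((Θ ++ Δ) ∷ G)
  cut {Θ} {Δ} X h₁ h₂ = CAN [1] [1] X refl
    (exS (↭-solve 4 (λ θ x nx δ → ((θ & x) & (nx & δ)) ≋ ((θ & δ) & (x & nx))) ↭-refl
            Θ ([1] · X) ([1] · neg X) Δ)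
      (M h₁ h₂))

  ⊔-inv-premise : ∀ A B K →
                  HR (([1] · A ++ [1] · neg (A ⊔ B)) ∷ ([1] · B ++ [1] · neg (A ⊔ B)) ∷ K)
  ⊔-inv-premise A B K =
    MEET {Γ = [1] · A} [1] (neg A) (neg B) (W₂ (ID₁ A))
      (swapH (MEET {Γ = [1] · B} [1] (neg A) (neg B) crossed (W₂ (ID₁ B))))
    where
    ID₁ : ∀ A {K′} → HR (([1] · A ++ [1] · neg A) ∷ K′)
    ID₁ A = generalised-ID A [1] [1] refl [] (INIT⁺ _)
    crossed : HR (([1] · B ++ [1] · neg A) ∷ ([1] · A ++ [1] · neg B) ∷ K)
    crossed = S (exS (↭-solve 4 (λ a na b nb → ((a & na) & (b & nb)) ≋ ((b & na) & (a & nb))) ↭-refl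
                        ([1] · A) ([1] · neg A) ([1] · B) ([1] · neg B))
                  (M (ID₁ A) (ID₁ B)))

  ⊔-inv : ∀ A B K → HR ([1] · (A ⊔ B) ∷ K) → HR ([1] · A ∷ [1] · B ∷ K)
  ⊔-inv A B K h =
    swapH (cut {Θ = []} (A ⊔ B) (W₂ h) (exS (↭.++-comm ([1] · B) _)
      (swapH (cut {Θ = []} (A ⊔ B) (W₂ h) (exS (↭.++-comm ([1] · A) _) (⊔-inv-premise A B K))))))

  sequent-⊑ : ∀ Γ → Intro ([1] · neg (nnf ⟦ Γ ⟧ˢ) ++ Γ)
  sequent-⊑ [] = Intro-↭ (↭-reflexive (sym (List.++-identityʳ _))) (ZEROᵗ [1])
  sequent-⊑ ((r , A) ∷ Γ) =
    Intro-rule (Rule-++ˡ (PLUSᵗ [1] _ _))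
      (Intro-↭ (↭-interchange ([1] · _) ((r , A) ∷ []) ([1] · _) Γ)
        (Intro-++ (weighted-⊑ (compare 0ℝ (proj₁ r)) (nnf-⟦⟧-⊑ A)) (sequent-⊑ Γ)))
    where
    weighted-⊑ : ∀ tr {Y} → Y ⊑ A → Intro ([1] · neg (scaleTri (proj₁ r) tr Y) ++ (r , A) ∷ [])
    weighted-⊑ (tri< 0<r _ _) {Y} Y⊑A =
      Intro-rule (Rule-++ˡ (TIMESᵗ [1] r′ (neg Y)))
        (Intro-↭ (↭.++-comm ((r , A) ∷ []) _) (Y⊑A (r ∷ []) (scaleV r′ [1]) r≡r*1))
      where
      r′ = proj₁ r , 0<r
      r≡r*1 : proj₁ r + 0ℝ ≡ proj₁ r * 1ℝ + 0ℝ
      r≡r*1 = cong (_+ 0ℝ) (sym (ℝ.*-identityʳ _))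
    weighted-⊑ (tri≈ 0≮r _ _) _ = ⊥-elim (0≮r (proj₂ r))
    weighted-⊑ (tri> 0≮r _ _) _ = ⊥-elim (0≮r (proj₂ r))

  sequent-inv : ∀ Γ K → HR ([1] · nnf ⟦ Γ ⟧ˢ ∷ K) → HR (Γ ∷ K)
  sequent-inv Γ K h = cut {Θ = []} (nnf ⟦ Γ ⟧ˢ) h (sequent-⊑ Γ [] (INIT⁺ K))

  hypersequent-inv : ∀ Γ G K → HR ([1] · nnf ⟦ Γ ∣ G ⟧ʰ ∷ K) → HR (Γ ∷ G ++ K)
  hypersequent-inv Γ []      K h = sequent-inv Γ K h
  hypersequent-inv Γ (Δ ∷ G) K h =
    sequent-inv Γ (Δ ∷ G ++ K) (exH (↭.shift ([1] · X) (Δ ∷ G) K)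
      (hypersequent-inv Δ G ([1] · X ∷ K) (swapH (⊔-inv X (nnf ⟦ Δ ∣ G ⟧ʰ) K h))))
    where X = nnf ⟦ Γ ⟧ˢ

  completeness : (Γ : Sequent) (G : List Sequent) → 0ᵗ ≤ₑ ⟦ Γ ∣ G ⟧ʰ → HR (Γ ∷ G)
  completeness Γ G 0≤⟦G⟧ =
    subst (λ G′ → HR (Γ ∷ G′)) (List.++-identityʳ G)
      (hypersequent-inv Γ G [] (𝟘⊑⇒Intro 𝟘⊑⟦G⟧ [] INIT))
    where
    𝟘⊑⟦G⟧ : 𝟘 ⊑ nnf ⟦ Γ ∣ G ⟧ʰ
    𝟘⊑⟦G⟧ = ⊑-trans (proj₂ (≈ₑ⇒⊑⊒ 0≤⟦G⟧)) (⊓-lowerʳ ⊑-refl)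

theorem3p10 : (R : Reals) → let open Syntax R in
    (Γ : Sequent) (G : List Sequent) →
    0ᵗ ≤ₑ ⟦ Γ ∣ G ⟧ʰ → HR (Γ ∷ G)
theorem3p10 R = Completeness.completeness R
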